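{- Let $T$ be a pre-Galois word, $p_o=\mathrm{Per}_o(T)$ and $p_e=\mathrm{Per}_e(T)$. Let $z$ be a symbol and $T'=T\cdot z$, and suppose that $T'[1..|T|-p_o+1]\preceq_{\mathrm{alt}}T'[p_o+1..|T|+1]$ and $T'[1..|T|-p_e+1]\preceq_{\mathrm{alt}}T'[p_e+1..|T|+1]$. Then $T'$ is pre-Galois.
   Context: $W[i..j]$ is the factor from position $i$ to $j$ (1-indexed), and is $\varepsilon$ if $i>j$. An integer $p\in[1..|W|]$ is a period of $W$ if $W[i+p]=W[i]$ for all $i\in[1..|W|-p]$. $\mathrm{Per}_o(W)$ (resp. $\mathrm{Per}_e(W)$) is the shortest odd (resp. even) period of $W$, set to $|W|+1$ if none exists. Alternating order: for words $S,T$ with $S^\omega\neq T^\omega$ ($X^\omega$ the infinite repetition of $X$), let $j$ be the first position with $S^\omega[j]\neq T^\omega[j]$; $S\prec_{\mathrm{alt}}T$ if $j$ is odd and $S^\omega[j]<T^\omega[j]$, or $j$ is even and $S^\omega[j]>T^\omega[j]$. $S=_{\mathrm{alt}}T$ if $S^\omega=T^\omega$; $\varepsilon\succ_{\mathrm{alt}}X$ for every nonempty $X$; $S\preceq_{\mathrm{alt}}T$ means $S\prec_{\mathrm{alt}}T$ or $S=_{\mathrm{alt}}T$. A word $T$ is pre-Galois if every proper suffix $S$ of $T$ is a prefix of $T$ or satisfies $S\succ_{\mathrm{alt}}T$. -}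

module Defs where

open import Data.Nat using (ℕ; zero; suc; _+_; _∸_; _≤_; _<_; _>_; _%_)
open import Data.List using (List; []; _∷_; length; take; drop; _++_; [_])
open import Data.Product using (Σ; _×_; ∃; ∃-syntax)
open import Data.Sum using (_⊎_)
open import Data.Empty using (⊥)
open import Data.Unit using (⊤)
open import Relation.Binary.PropositionalEquality using (_≡_)

Word : Set
Word = List ℕ

-- 0-indexed access (default value irrelevant: only used in range)
at : Word → ℕ → ℕ
at []       _       = 0
at (x ∷ _)  zero    = x
at (_ ∷ xs) (suc k) = at xs k

-- W[i..j], 1-indexed, empty if i > j (used with i ≥ 1)
fac : Word → ℕ → ℕ → Word
fac W i j = take ((j + 1) ∸ i) (drop (i ∸ 1) W)

_!_ : Word → ℕ → ℕ
W ! i = at W (i ∸ 1)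

Odd : ℕ → Set
Odd n = n % 2 ≡ 1

Even : ℕ → Set
Even n = n % 2 ≡ 0

IsPeriod : Word → ℕ → Set
IsPeriod W p = 1 ≤ p × p ≤ length W ×
  (∀ i → 1 ≤ i → i ≤ length W ∸ p → W ! (i + p) ≡ W ! i)

IsPerO : Word → ℕ → Set
IsPerO W p =
  (Odd p × IsPeriod W p × (∀ q → Odd q → IsPeriod W q → p ≤ q))
  ⊎ ((∀ q → Odd q → IsPeriod W q → ⊥) × p ≡ suc (length W))

IsPerE : Word → ℕ → Set
IsPerE W p =
  (Even p × IsPeriod W p × (∀ q → Even q → IsPeriod W q → p ≤ q))
  ⊎ ((∀ q → Even q → IsPeriod W q → ⊥) × p ≡ suc (length W))

-- X^ω[k] (0-indexed) for nonempty X = x ∷ xs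
omega : ℕ → Word → ℕ → ℕ
omega x xs k = at (x ∷ xs) (k % suc (length xs))

_=alt_ : Word → Word → Set
[]      =alt []      = ⊤
[]      =alt (_ ∷ _) = ⊥
(_ ∷ _) =alt []      = ⊥
(s ∷ ss) =alt (t ∷ ts) = ∀ k → omega s ss k ≡ omega t ts k

-- S ≺alt T. With 0-indexed first difference j, position j+1 is odd iff j is even.
_≺alt_ : Word → Word → Set
[]       ≺alt _        = ⊥
(_ ∷ _)  ≺alt []       = ⊤
(s ∷ ss) ≺alt (t ∷ ts) = ∃[ j ]
  ((∀ k → k < j → omega s ss k ≡ omega t ts k) ×
   ((Even j × omega s ss j < omega t ts j) ⊎
    (Odd j  × omega s ss j > omega t ts j)))

_⪯alt_ : Word → Word → Set
S ⪯alt T = (S ≺alt T) ⊎ (S =alt T)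

IsPrefix : Word → Word → Set
IsPrefix S T = ∃[ U ] (S ++ U ≡ T)

PreGalois : Word → Set
PreGalois T = ∀ k → 1 ≤ k → k ≤ length T →
  IsPrefix (drop k T) T ⊎ (T ≺alt drop k T)

{-# OPTIONS --safe #-}
module Submission where

open import Defs
open import Data.Nat using (ℕ; NonZero; zero; suc; _+_; _∸_; _≤_; _<_; _>_; _%_; s≤s; z<s; _≟_; _<?_)
open import Data.Nat.Properties
open import Data.Nat.DivMod using (%-distribˡ-+; m<n⇒m%n≡m)
open import Data.List using ([]; _∷_; length; _++_; [_]; take; drop)
open import Data.List.Properties using (++-assoc; length-++; length-take; length-drop; drop-all)
open import Data.Product using (_×_; _,_; ∃-syntax; proj₁)
open import Data.Sum using (_⊎_; inj₁; inj₂; map₂)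
open import Data.Empty using (⊥; ⊥-elim)
open import Relation.Nullary using (Dec; yes; no; contradiction)
open import Relation.Binary using (tri<; tri≈; tri>)
open import Relation.Binary.PropositionalEquality hiding ([_])
open ≡-Reasoning

-- Every nonempty proper suffix of T z is S z for a proper suffix S = drop k T of T. If T ≺alt S is
-- witnessed by a difference inside S, the same difference gives T z ≺alt S z. Otherwise S is a border
-- of T, so k is a period, and the comparison of T z with S z happens at j = |S|: T[j] against z.
-- Let p ≤ k be the shortest period of T with the parity of k, so that d = k − p is even. As T has the
-- periods p and k, T and its suffix from d agree on their first j letters, so pre-Galois gives
-- T[j] ⪯ T[d + j] in the order of position j; the hypothesis on p gives T[d + j] ⪯ z in the order of
-- position d + j, which is the same order since d is even. Hence S z is a prefix of T z or T z ≺alt S z.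

Even⊎Odd : ∀ n → Even n ⊎ Odd n
Even⊎Odd zero          = inj₁ refl
Even⊎Odd (suc zero)    = inj₂ refl
Even⊎Odd (suc (suc n)) = Even⊎Odd n

suc-%2-injective : ∀ m n → suc m % 2 ≡ suc n % 2 → m % 2 ≡ n % 2
suc-%2-injective (suc (suc m)) n             eq = suc-%2-injective m n eq
suc-%2-injective m             (suc (suc n)) eq = suc-%2-injective m n eq
suc-%2-injective zero          zero          _  = refl
suc-%2-injective (suc zero)    (suc zero)    _  = refl

+-%2-cancelˡ : ∀ a {m n} → (a + m) % 2 ≡ (a + n) % 2 → m % 2 ≡ n % 2
+-%2-cancelˡ zero                  eq = eq
+-%2-cancelˡ (suc zero)    {m} {n} eq = suc-%2-injective m n eq
+-%2-cancelˡ (suc (suc a))         eq = +-%2-cancelˡ a eq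

%-congˡ-+ : ∀ {a b} c n .{{_ : NonZero n}} → a % n ≡ b % n → (a + c) % n ≡ (b + c) % n
%-congˡ-+ {a} {b} c n a≡b = begin
  (a + c) % n            ≡⟨ %-distribˡ-+ a c n ⟩
  (a % n + c % n) % n    ≡⟨ cong (λ r → (r + c % n) % n) a≡b ⟩
  (b % n + c % n) % n    ≡⟨ %-distribˡ-+ b c n ⟨
  (b + c) % n            ∎

offsets-parity : ∀ {p m k j} → p + m ≡ k + j → p % 2 ≡ k % 2 → m % 2 ≡ j % 2
offsets-parity {p} {m} {k} {j} p+m≡k+j p≡k = +-%2-cancelˡ k (begin
  (k + m) % 2  ≡⟨ %-congˡ-+ {k} {p} m 2 (sym p≡k) ⟩
  (p + m) % 2  ≡⟨ cong (_% 2) p+m≡k+j ⟩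
  (k + j) % 2  ∎)

at-++ˡ : ∀ xs ys {i} → i < length xs → at (xs ++ ys) i ≡ at xs i
at-++ˡ (x ∷ xs) ys {zero}  _         = refl
at-++ˡ (x ∷ xs) ys {suc i} (s≤s i<n) = at-++ˡ xs ys i<n

at-++-length : ∀ xs {y} ys → at (xs ++ y ∷ ys) (length xs) ≡ y
at-++-length []       ys = refl
at-++-length (x ∷ xs) ys = at-++-length xs ys

at-drop : ∀ n xs i → at (drop n xs) i ≡ at xs (n + i)
at-drop zero    xs       i = refl
at-drop (suc n) []       i = refl
at-drop (suc n) (x ∷ xs) i = at-drop n xs i

at-take : ∀ n xs {i} → i < n → at (take n xs) i ≡ at xs i
at-take (suc n) []       _         = refl
at-take (suc n) (x ∷ xs) {zero}  _ = refl
at-take (suc n) (x ∷ xs) {suc i} (s≤s i<n) = at-take n xs i<n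

<-length-take : ∀ n (xs : Word) {i} → i < n → i < length xs → i < length (take n xs)
<-length-take n xs {i} i<n i<xs = subst (i <_) (sym (length-take n xs)) (⊓-glb i<n i<xs)

<-length-drop : ∀ n (xs : Word) {i} → n + i < length xs → i < length (drop n xs)
<-length-drop n xs {i} n+i<xs =
  subst (i <_) (sym (length-drop n xs))
    (m+n≤o⇒m≤o∸n (suc i) (subst (λ m → suc m ≤ length xs) (+-comm n i) n+i<xs))

<-length-++ˡ : ∀ (xs ys : Word) {i} → i < length xs → i < length (xs ++ ys)
<-length-++ˡ xs ys i<xs = <-≤-trans i<xs (subst (length xs ≤_) (sym (length-++ xs)) (m≤m+n _ _))

length<length-snoc : ∀ (xs : Word) y → length xs < length (xs ++ [ y ])
length<length-snoc xs y = subst (length xs <_) (sym (length-++ xs)) (m<m+n _ z<s)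

drop-++ˡ : ∀ {n} (xs ys : Word) → n ≤ length xs → drop n (xs ++ ys) ≡ drop n xs ++ ys
drop-++ˡ {zero}  xs       ys _         = refl
drop-++ˡ {suc n} (x ∷ xs) ys (s≤s n≤l) = drop-++ˡ xs ys n≤l

fac-from : ∀ W p n → fac W (p + 1) n ≡ take (n ∸ p) (drop p W)
fac-from W p n = cong₂ (λ a b → take a (drop b W)) (cong₂ _∸_ (+-comm n 1) (+-comm p 1)) (m+n∸n≡m p 1)

AgreeBelow : ℕ → Word → Word → Set
AgreeBelow j A B = ∀ i → i < j → at A i ≡ at B i

AgreeBelow-++ : ∀ {j} A B X Y → j ≤ length A → j ≤ length B →
  AgreeBelow j A B → AgreeBelow j (A ++ X) (B ++ Y)
AgreeBelow-++ A B X Y j≤A j≤B agree i i<j = begin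
  at (A ++ X) i  ≡⟨ at-++ˡ A X (<-≤-trans i<j j≤A) ⟩
  at A i         ≡⟨ agree i i<j ⟩
  at B i         ≡⟨ at-++ˡ B Y (<-≤-trans i<j j≤B) ⟨
  at (B ++ Y) i  ∎

AgreeBelow⇒IsPrefix : ∀ A B → length A ≤ length B → AgreeBelow (length A) A B → IsPrefix A B
AgreeBelow⇒IsPrefix []      B       _         _     = B , refl
AgreeBelow⇒IsPrefix (a ∷ A) (b ∷ B) (s≤s A≤B) agree
  with AgreeBelow⇒IsPrefix A B A≤B (λ i i<A → agree (suc i) (s≤s i<A))
... | U , A++U≡B = U , cong₂ _∷_ (agree 0 z<s) A++U≡B

IsPrefix⇒at : ∀ {A B i} → IsPrefix A B → i < length A → at B i ≡ at A i
IsPrefix⇒at {A} (U , refl) i<A = at-++ˡ A U i<A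

IsPrefix-++ʳ : ∀ {A B} C → IsPrefix A B → IsPrefix A (B ++ C)
IsPrefix-++ʳ {A} C (U , refl) = U ++ C , sym (++-assoc A U C)

IsPrefix-extend : ∀ {A B} → IsPrefix A B → length A < length B → IsPrefix (A ++ [ at B (length A) ]) B
IsPrefix-extend {A} ([] , refl) A<B =
  ⊥-elim (<-irrefl refl (subst (length A <_) (trans (length-++ A) (+-identityʳ _)) A<B))
IsPrefix-extend {A} (u ∷ U , refl) _ rewrite at-++-length A {u} U = U , ++-assoc A [ u ] U

HasPeriod : Word → ℕ → Set
HasPeriod W p = ∀ i → p + i < length W → at W (p + i) ≡ at W i

IsPeriod⇒HasPeriod : ∀ {W p} → IsPeriod W p → HasPeriod W p
IsPeriod⇒HasPeriod {W} {p} (_ , _ , period) i p+i<W = begin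
  at W (p + i)  ≡⟨ cong (at W) (+-comm p i) ⟩
  at W (i + p)  ≡⟨ period (suc i) z<s (m+n≤o⇒m≤o∸n (suc i) (subst (_< length W) (+-comm p i) p+i<W)) ⟩
  at W i        ∎

HasPeriod⇒IsPeriod : ∀ {W p} → 1 ≤ p → p ≤ length W → HasPeriod W p → IsPeriod W p
HasPeriod⇒IsPeriod {W} {p} 1≤p p≤W period = 1≤p , p≤W , period′
  where
  period′ : ∀ i → 1 ≤ i → i ≤ length W ∸ p → W ! (i + p) ≡ W ! i
  period′ (suc i) _ i<W∸p = begin
    at W (i + p)  ≡⟨ cong (at W) (+-comm i p) ⟩
    at W (p + i)  ≡⟨ period i (subst (_< length W) (+-comm i p) i+p<W) ⟩
    at W i        ∎
    where
    i+p<W : i + p < length W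
    i+p<W = subst (suc (i + p) ≤_) (m∸n+n≡m p≤W) (+-monoˡ-≤ p i<W∸p)

IsPrefix-drop⇒HasPeriod : ∀ {W k} → IsPrefix (drop k W) W → HasPeriod W k
IsPrefix-drop⇒HasPeriod {W} {k} border i k+i<W = begin
  at W (k + i)     ≡⟨ at-drop k W i ⟨
  at (drop k W) i  ≡⟨ IsPrefix⇒at border (<-length-drop k W k+i<W) ⟨
  at W i           ∎

periods⇒AgreeBelow-drop : ∀ {W p d j} → HasPeriod W p → HasPeriod W (p + d) →
  p + d + j ≤ length W → AgreeBelow j W (drop d W)
periods⇒AgreeBelow-drop {W} {p} {d} {j} period-p period-p+d bound i i<j = begin
  at W i              ≡⟨ period-p+d i p+d+i<W ⟨
  at W (p + d + i)    ≡⟨ cong (at W) (+-assoc p d i) ⟩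
  at W (p + (d + i))  ≡⟨ period-p (d + i) (subst (_< length W) (+-assoc p d i) p+d+i<W) ⟩
  at W (d + i)        ≡⟨ at-drop d W i ⟨
  at (drop d W) i     ∎
  where
  p+d+i<W : p + d + i < length W
  p+d+i<W = <-≤-trans (+-monoʳ-< (p + d) i<j) bound

AltLt : ℕ → ℕ → ℕ → Set
AltLt j x y = (Even j × x < y) ⊎ (Odd j × x > y)

AltLe : ℕ → ℕ → ℕ → Set
AltLe j x y = x ≡ y ⊎ AltLt j x y

AltLt-irrefl : ∀ {j x} → AltLt j x x → ⊥
AltLt-irrefl (inj₁ (_ , x<x)) = <-irrefl refl x<x
AltLt-irrefl (inj₂ (_ , x<x)) = <-irrefl refl x<x

AltLt-parity : ∀ {j j′ x y} → j % 2 ≡ j′ % 2 → AltLt j x y → AltLt j′ x y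
AltLt-parity j≡j′ (inj₁ (even , x<y)) = inj₁ (trans (sym j≡j′) even , x<y)
AltLt-parity j≡j′ (inj₂ (odd , x>y))  = inj₂ (trans (sym j≡j′) odd , x>y)

AltLe-parity : ∀ {j j′ x y} → j % 2 ≡ j′ % 2 → AltLe j x y → AltLe j′ x y
AltLe-parity {j} {j′} j≡j′ = map₂ (AltLt-parity {j} {j′} j≡j′)

AltLe-trans : ∀ {j x y w} → AltLe j x y → AltLe j y w → AltLe j x w
AltLe-trans (inj₁ refl) y⪯w = y⪯w
AltLe-trans (inj₂ x≺y) (inj₁ refl) = inj₂ x≺y
AltLe-trans (inj₂ (inj₁ (even , x<y))) (inj₂ (inj₁ (_ , y<w))) = inj₂ (inj₁ (even , <-trans x<y y<w))
AltLe-trans (inj₂ (inj₂ (odd , x>y)))  (inj₂ (inj₂ (_ , y>w))) = inj₂ (inj₂ (odd , <-trans y>w x>y))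
AltLe-trans (inj₂ (inj₁ (even , _))) (inj₂ (inj₂ (odd , _))) = contradiction (trans (sym even) odd) λ ()
AltLe-trans (inj₂ (inj₂ (odd , _))) (inj₂ (inj₁ (even , _))) = contradiction (trans (sym even) odd) λ ()

AltLe⇒AltLt : ∀ {j x y} → AltLe j x y → x ≢ y → AltLt j x y
AltLe⇒AltLt (inj₁ x≡y) x≢y = contradiction x≡y x≢y
AltLe⇒AltLt (inj₂ x≺y) _   = x≺y

omega-at : ∀ x xs {k} → k < length (x ∷ xs) → omega x xs k ≡ at (x ∷ xs) k
omega-at x xs k<n = cong (at (x ∷ xs)) (m<n⇒m%n≡m k<n)

omega⇒AgreeBelow : ∀ {a as b bs j} → j ≤ length (a ∷ as) → j ≤ length (b ∷ bs) →
  (∀ k → k < j → omega a as k ≡ omega b bs k) → AgreeBelow j (a ∷ as) (b ∷ bs)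
omega⇒AgreeBelow {a} {as} {b} {bs} j≤A j≤B agree i i<j = begin
  at (a ∷ as) i  ≡⟨ omega-at a as (<-≤-trans i<j j≤A) ⟨
  omega a as i   ≡⟨ agree i i<j ⟩
  omega b bs i   ≡⟨ omega-at b bs (<-≤-trans i<j j≤B) ⟩
  at (b ∷ bs) i  ∎

AltMismatch : Word → Word → Set
AltMismatch A B = ∃[ j ] (j < length A × j < length B × AgreeBelow j A B × AltLt j (at A j) (at B j))

AltMismatch⇒≺alt : ∀ {A B} → AltMismatch A B → A ≺alt B
AltMismatch⇒≺alt {a ∷ as} {b ∷ bs} (j , j<A , j<B , agree , a≺b) =
  j , omega-agree , subst₂ (AltLt j) (sym (omega-at a as j<A)) (sym (omega-at b bs j<B)) a≺b
  where
  omega-agree : ∀ k → k < j → omega a as k ≡ omega b bs k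
  omega-agree k k<j = begin
    omega a as k   ≡⟨ omega-at a as (<-trans k<j j<A) ⟩
    at (a ∷ as) k  ≡⟨ agree k k<j ⟩
    at (b ∷ bs) k  ≡⟨ omega-at b bs (<-trans k<j j<B) ⟨
    omega b bs k   ∎

AltMismatch-++ : ∀ {A B} X Y → AltMismatch A B → AltMismatch (A ++ X) (B ++ Y)
AltMismatch-++ {A} {B} X Y (j , j<A , j<B , agree , a≺b) =
  j , <-length-++ˡ A X j<A , <-length-++ˡ B Y j<B ,
  AgreeBelow-++ A B X Y (<⇒≤ j<A) (<⇒≤ j<B) agree ,
  subst₂ (AltLt j) (sym (at-++ˡ A X j<A)) (sym (at-++ˡ B Y j<B)) a≺b

≺alt⇒IsPrefix⊎AltMismatch : ∀ {A B} → length B ≤ length A → A ≺alt B → IsPrefix B A ⊎ AltMismatch A B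
≺alt⇒IsPrefix⊎AltMismatch {A}      {[]}     _   _ = inj₁ (A , refl)
≺alt⇒IsPrefix⊎AltMismatch {a ∷ as} {b ∷ bs} B≤A (j , agree , a≺b) with j <? length (b ∷ bs)
... | yes j<B = inj₂ (j , j<A , j<B , omega⇒AgreeBelow (<⇒≤ j<A) (<⇒≤ j<B) agree ,
                      subst₂ (AltLt j) (omega-at a as j<A) (omega-at b bs j<B) a≺b)
  where
  j<A : j < length (a ∷ as)
  j<A = <-≤-trans j<B B≤A
... | no j≮B = inj₁ (AgreeBelow⇒IsPrefix (b ∷ bs) (a ∷ as) B≤A
                      (omega⇒AgreeBelow ≤-refl B≤A λ k k<B → sym (agree k (<-≤-trans k<B (≮⇒≥ j≮B)))))

≺alt⇒AltLe : ∀ {A B j} → j < length A → j < length B → AgreeBelow j A B →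
  A ≺alt B → AltLe j (at A j) (at B j)
≺alt⇒AltLe {a ∷ as} {b ∷ bs} {j} j<A j<B agree (j′ , agree′ , a≺b) with <-cmp j′ j
... | tri< j′<j _ _ = ⊥-elim (AltLt-irrefl {j′} (subst₂ (AltLt j′) a≡ b≡ a≺b))
  where
  a≡ : omega a as j′ ≡ at (a ∷ as) j′
  a≡ = omega-at a as (<-trans j′<j j<A)
  b≡ : omega b bs j′ ≡ at (a ∷ as) j′
  b≡ = trans (omega-at b bs (<-trans j′<j j<B)) (sym (agree j′ j′<j))
... | tri≈ _ refl _ = inj₂ (subst₂ (AltLt j) (omega-at a as j<A) (omega-at b bs j<B) a≺b)
... | tri> _ _ j<j′ = inj₁ (begin
  at (a ∷ as) j  ≡⟨ omega-at a as j<A ⟨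
  omega a as j   ≡⟨ agree′ j j<j′ ⟩
  omega b bs j   ≡⟨ omega-at b bs j<B ⟩
  at (b ∷ bs) j  ∎)

=alt⇒at≡ : ∀ {A B j} → j < length A → j < length B → A =alt B → at A j ≡ at B j
=alt⇒at≡ {a ∷ as} {b ∷ bs} {j} j<A j<B A=B = begin
  at (a ∷ as) j  ≡⟨ omega-at a as j<A ⟨
  omega a as j   ≡⟨ A=B j ⟩
  omega b bs j   ≡⟨ omega-at b bs j<B ⟩
  at (b ∷ bs) j  ∎

⪯alt⇒AltLe : ∀ {A B j} → j < length A → j < length B → AgreeBelow j A B →
  A ⪯alt B → AltLe j (at A j) (at B j)
⪯alt⇒AltLe j<A j<B agree (inj₁ A≺B) = ≺alt⇒AltLe j<A j<B agree A≺B
⪯alt⇒AltLe j<A j<B _     (inj₂ A=B) = inj₁ (=alt⇒at≡ j<A j<B A=B)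

take-⪯alt⇒AltLe : ∀ {X Y n j} → j < n → j < length X → j < length Y → AgreeBelow j X Y →
  take n X ⪯alt take n Y → AltLe j (at X j) (at Y j)
take-⪯alt⇒AltLe {X} {Y} {n} {j} j<n j<X j<Y agree X⪯Y =
  subst₂ (AltLe j) (at-take n X j<n) (at-take n Y j<n)
    (⪯alt⇒AltLe (<-length-take n X j<n j<X) (<-length-take n Y j<n j<Y) agree′ X⪯Y)
  where
  agree′ : AgreeBelow j (take n X) (take n Y)
  agree′ i i<j = begin
    at (take n X) i  ≡⟨ at-take n X (<-trans i<j j<n) ⟩
    at X i           ≡⟨ agree i i<j ⟩
    at Y i           ≡⟨ at-take n Y (<-trans i<j j<n) ⟨
    at (take n Y) i  ∎

AltCompatible : Word → ℕ → ℕ → Set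
AltCompatible T z p = fac (T ++ [ z ]) 1 ((length T + 1) ∸ p) ⪯alt fac (T ++ [ z ]) (p + 1) (length T + 1)

AltCompatible⇒AltLe : ∀ {T z p m} → 1 ≤ p → length T ≡ p + m → HasPeriod T p →
  AltCompatible T z p → AltLe m (at T m) z
AltCompatible⇒AltLe {T} {z} {p} {m} 1≤p |T|≡p+m period compatible =
  subst₂ (AltLe m) (at-++ˡ T [ z ] m<T) Y[m]≡z
    (take-⪯alt⇒AltLe m<n (<-length-++ˡ T [ z ] m<T) (<-length-drop p W p+m<W) agree
      (subst₂ _⪯alt_ (fac-from W 0 _) (fac-from W p _) compatible))
  where
  W = T ++ [ z ]
  m<T : m < length T
  m<T = subst (m <_) (sym |T|≡p+m) (m<n+m m 1≤p)
  p+m<W : p + m < length W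
  p+m<W = subst (_< length W) |T|≡p+m (length<length-snoc T z)
  m<n : m < length T + 1 ∸ p
  m<n = subst (m <_) (sym |T|+1∸p≡m+1) (m<m+n m z<s)
    where
    |T|+1∸p≡m+1 : length T + 1 ∸ p ≡ m + 1
    |T|+1∸p≡m+1 = trans (cong (λ l → l + 1 ∸ p) |T|≡p+m)
                        (trans (cong (_∸ p) (+-assoc p m 1)) (m+n∸m≡n p (m + 1)))
  agree : AgreeBelow m W (drop p W)
  agree i i<m = begin
    at W i            ≡⟨ at-++ˡ T [ z ] i<T ⟩
    at T i            ≡⟨ period i p+i<T ⟨
    at T (p + i)      ≡⟨ at-++ˡ T [ z ] p+i<T ⟨
    at W (p + i)      ≡⟨ at-drop p W i ⟨
    at (drop p W) i   ∎
    where
    p+i<T : p + i < length T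
    p+i<T = subst (p + i <_) (sym |T|≡p+m) (+-monoʳ-< p i<m)
    i<T : i < length T
    i<T = <-trans i<m m<T
  Y[m]≡z : at (drop p W) m ≡ z
  Y[m]≡z = begin
    at (drop p W) m   ≡⟨ at-drop p W m ⟩
    at W (p + m)      ≡⟨ cong (at W) |T|≡p+m ⟨
    at W (length T)   ≡⟨ at-++-length T [] ⟩
    z                 ∎

preGalois⇒AltLe : ∀ {T d j} → PreGalois T → d + j < length T → AgreeBelow j T (drop d T) →
  AltLe j (at T j) (at T (d + j))
preGalois⇒AltLe {T} {zero}  _         _     _     = inj₁ refl
preGalois⇒AltLe {T} {suc d} {j} preGalois d+j<T agree =
  subst (AltLe j (at T j)) (at-drop (suc d) T j) T[j]⪯S[j]
  where
  S = drop (suc d) T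
  j<S : j < length S
  j<S = <-length-drop (suc d) T d+j<T
  T[j]⪯S[j] : AltLe j (at T j) (at S j)
  T[j]⪯S[j] with preGalois (suc d) z<s (m+n≤o⇒m≤o (suc d) (<⇒≤ d+j<T))
  ... | inj₁ border = inj₁ (IsPrefix⇒at border j<S)
  ... | inj₂ T≺S    = ≺alt⇒AltLe (<-trans (m<n+m j z<s) d+j<T) j<S agree T≺S

border-AltLt : ∀ {T z k j p} → PreGalois T → HasPeriod T k → length T ≡ k + j → at T j ≢ z →
  IsPeriod T p → p ≤ k → p % 2 ≡ k % 2 → AltCompatible T z p → AltLt j (at T j) z
border-AltLt {T} {z} {k} {j} {p} preGalois period-k |T|≡k+j T[j]≢z period-p p≤k p≡k compatible =
  AltLe⇒AltLt {j} (AltLe-trans {j} T[j]⪯T[d+j] (AltLe-parity {d + j} {j} d+j≡j T[d+j]⪯z)) T[j]≢z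
  where
  d = k ∸ p
  k≡p+d : k ≡ p + d
  k≡p+d = sym (m+[n∸m]≡n p≤k)
  |T|≡p+d+j : length T ≡ p + d + j
  |T|≡p+d+j = trans |T|≡k+j (cong (_+ j) k≡p+d)
  |T|≡p+[d+j] : length T ≡ p + (d + j)
  |T|≡p+[d+j] = trans |T|≡p+d+j (+-assoc p d j)
  T[j]⪯T[d+j] : AltLe j (at T j) (at T (d + j))
  T[j]⪯T[d+j] = preGalois⇒AltLe preGalois
    (subst (d + j <_) (sym |T|≡p+[d+j]) (m<n+m (d + j) (proj₁ period-p)))
    (periods⇒AgreeBelow-drop (IsPeriod⇒HasPeriod {T} period-p) (subst (HasPeriod T) k≡p+d period-k)
      (≤-reflexive (sym |T|≡p+d+j)))
  T[d+j]⪯z : AltLe (d + j) (at T (d + j)) z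
  T[d+j]⪯z = AltCompatible⇒AltLe {T} {z} (proj₁ period-p) |T|≡p+[d+j]
    (IsPeriod⇒HasPeriod {T} period-p) compatible
  d+j≡j : (d + j) % 2 ≡ j % 2
  d+j≡j = offsets-parity {p} {d + j} {k} {j} (trans (sym |T|≡p+[d+j]) |T|≡k+j) p≡k

AltCompatiblePeriodBelow : Word → ℕ → ℕ → Set
AltCompatiblePeriodBelow T z k = ∃[ p ] (IsPeriod T p × p ≤ k × p % 2 ≡ k % 2 × AltCompatible T z p)

shortest-periods⇒AltCompatiblePeriodBelow : ∀ {T z po pe} → IsPerO T po → IsPerE T pe →
  AltCompatible T z po → AltCompatible T z pe →
  ∀ {k} → IsPeriod T k → AltCompatiblePeriodBelow T z k
shortest-periods⇒AltCompatiblePeriodBelow perO perE compatible-o compatible-e {k} period-k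
  with Even⊎Odd k | perO | perE
... | inj₁ even | _ | inj₁ (even-pe , period-pe , shortest) =
  _ , period-pe , shortest k even period-k , trans even-pe (sym even) , compatible-e
... | inj₁ even | _ | inj₂ (none , _) = ⊥-elim (none k even period-k)
... | inj₂ odd | inj₁ (odd-po , period-po , shortest) | _ =
  _ , period-po , shortest k odd period-k , trans odd-po (sym odd) , compatible-o
... | inj₂ odd | inj₂ (none , _) | _ = ⊥-elim (none k odd period-k)

border-extends : ∀ {T z k} → PreGalois T →
  (∀ {k} → IsPeriod T k → AltCompatiblePeriodBelow T z k) → 1 ≤ k → k ≤ length T → IsPrefix (drop k T) T →
  IsPrefix (drop k T ++ [ z ]) (T ++ [ z ]) ⊎ AltMismatch (T ++ [ z ]) (drop k T ++ [ z ])
border-extends {T} {z} {k} preGalois compatible 1≤k k≤T border = extend (at T (length S) ≟ z)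
  where
  S = drop k T
  |T|≡k+|S| : length T ≡ k + length S
  |T|≡k+|S| = trans (sym (m+[n∸m]≡n k≤T)) (cong (k +_) (sym (length-drop k T)))
  S<T : length S < length T
  S<T = subst (length S <_) (sym |T|≡k+|S|) (m<n+m (length S) 1≤k)
  period-k : HasPeriod T k
  period-k = IsPrefix-drop⇒HasPeriod border
  extend : Dec (at T (length S) ≡ z) →
    IsPrefix (S ++ [ z ]) (T ++ [ z ]) ⊎ AltMismatch (T ++ [ z ]) (S ++ [ z ])
  extend (yes T[j]≡z) =
    inj₁ (IsPrefix-++ʳ [ z ] (subst (λ x → IsPrefix (S ++ [ x ]) T) T[j]≡z (IsPrefix-extend border S<T)))
  extend (no T[j]≢z) with compatible (HasPeriod⇒IsPeriod {T} 1≤k k≤T period-k)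
  ... | p , period-p , p≤k , p≡k , compatible-p =
    inj₂ (length S , <-length-++ˡ T [ z ] S<T , length<length-snoc S z ,
          AgreeBelow-++ T S [ z ] [ z ] (<⇒≤ S<T) ≤-refl (λ i i<S → IsPrefix⇒at border i<S) ,
          subst₂ (AltLt (length S)) (sym (at-++ˡ T [ z ] S<T)) (sym (at-++-length S []))
            (border-AltLt preGalois period-k |T|≡k+|S| T[j]≢z period-p p≤k p≡k compatible-p))

proper-suffix-extends : ∀ {T z k} → PreGalois T →
  (∀ {k} → IsPeriod T k → AltCompatiblePeriodBelow T z k) → 1 ≤ k → k ≤ length T →
  IsPrefix (drop k T ++ [ z ]) (T ++ [ z ]) ⊎ AltMismatch (T ++ [ z ]) (drop k T ++ [ z ])
proper-suffix-extends {T} {z} {k} preGalois compatible 1≤k k≤T with preGalois k 1≤k k≤T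
... | inj₁ border = border-extends preGalois compatible 1≤k k≤T border
... | inj₂ T≺S with ≺alt⇒IsPrefix⊎AltMismatch S≤T T≺S
  where
  S≤T : length (drop k T) ≤ length T
  S≤T = subst (_≤ length T) (sym (length-drop k T)) (m∸n≤m (length T) k)
...   | inj₁ border   = border-extends preGalois compatible 1≤k k≤T border
...   | inj₂ mismatch = inj₂ (AltMismatch-++ {T} {drop k T} [ z ] [ z ] mismatch)

lemma20 : (T : Word) (po pe z : ℕ) → PreGalois T → IsPerO T po → IsPerE T pe →
    fac (T ++ [ z ]) 1 ((length T + 1) ∸ po) ⪯alt fac (T ++ [ z ]) (po + 1) (length T + 1) →
    fac (T ++ [ z ]) 1 ((length T + 1) ∸ pe) ⪯alt fac (T ++ [ z ]) (pe + 1) (length T + 1) →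
    PreGalois (T ++ [ z ])
lemma20 T po pe z preGalois perO perE compatible-o compatible-e k 1≤k k≤T′ with m≤n⇒m<n∨m≡n k≤T′
... | inj₂ k≡T′ =
  inj₁ (T ++ [ z ] , cong (_++ (T ++ [ z ])) (drop-all k (T ++ [ z ]) (≤-reflexive (sym k≡T′))))
... | inj₁ k<T′ =
  subst (λ S → IsPrefix S (T ++ [ z ]) ⊎ (T ++ [ z ]) ≺alt S) (sym (drop-++ˡ T [ z ] k≤T))
    (map₂ AltMismatch⇒≺alt (proper-suffix-extends preGalois compatible 1≤k k≤T))
  where
  k≤T : k ≤ length T
  k≤T = ≤-pred (subst (k <_) (trans (length-++ T) (+-comm (length T) 1)) k<T′)
  compatible : ∀ {k} → IsPeriod T k → AltCompatiblePeriodBelow T z k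
  compatible = shortest-periods⇒AltCompatiblePeriodBelow perO perE compatible-o compatible-e
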